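{- Let $t,u$ be terms, let $\phi$ and $\psi_1,\dots,\psi_n$ be quantifier-free symbolic heaps, and let $z,y_1,y_2$ be variables not occurring in $t,u,\phi,\psi_1,\dots,\psi_n$. Then the following are equivalent: (1) $\mathrm{ls}(t,u)*\phi\models\psi_1\lor\cdots\lor\psi_n$; (2) both $t=u\land\phi\models\psi_1\lor\cdots\lor\psi_n$ and $t\mapsto(z,y_1)*z\mapsto(u,y_2)*\phi\models\psi_1\lor\cdots\lor\psi_n$.
   Context: Terms: $t::=x\mid0\mid1\mid\cdots\mid t+t$, interpreted in $N$ by a store $s$ (a map from variables to $N$, with $s(n)=n$, $s(t+u)=s(t)+s(u)$). A heap is a finite partial function $h$ from $N\setminus\{0\}$ to $N^2$. Quantifier-free symbolic heaps are $\Pi\land\Sigma$ with $\Pi$ a Presburger formula and $\Sigma::=\mathrm{Emp}\mid t\mapsto(t,t)\mid\mathrm{Arr}(t,t)\mid\mathrm{ls}(t,t)\mid\mathrm{dll}(t,t,t,t)\mid\Sigma*\Sigma$. Satisfaction: pure formulas hold iff true under $s$; $s,h\models\mathrm{Emp}$ iff $\mathrm{Dom}(h)=\emptyset$; $s,h\models t\mapsto(u,v)$ iff $\mathrm{Dom}(h)=\{s(t)\}$ and $h(s(t))=(s(u),s(v))$; $s,h\models\mathrm{Arr}(t,u)$ iff $s(t)\le s(u)$ and $\mathrm{Dom}(h)=\{x\mid s(t)\le x\le s(u)\}$; $s,h\models F_1*F_2$ iff $h=h_1+h_2$ (disjoint union) with $s,h_i\models F_i$; $\land,\lor,\exists$ classical.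 List predicates: $s,h\models\mathrm{ls}(t,u)$ iff $s,h\models\mathrm{ls}^k(t,u)$ for some $k\ge0$, and $s,h\models\mathrm{dll}(t,u,v,w)$ iff $s,h\models\mathrm{dll}^k(t,u,v,w)$ for some $k$, where $\mathrm{ls}^0$ and $\mathrm{dll}^0$ are $0\ne0\land\mathrm{Emp}$, $\mathrm{ls}^{k+1}(t,u)=(t=u\land\mathrm{Emp})\lor\exists z w(t\mapsto(z,w)*\mathrm{ls}^k(z,u))$, and $\mathrm{dll}^{k+1}(t,u,v,w)=(t=u\land v=w\land\mathrm{Emp})\lor\exists z(t\mapsto(z,w)*\mathrm{dll}^k(z,u,v,t))$. $F\models G$ means that for all $s,h$, $s,h\models F$ implies $s,h\models G$. -}

module Defs where

open import Data.Nat using (ℕ; _+_; _≤_; _≟_)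
open import Data.Fin using (Fin)
open import Data.Maybe using (Maybe; just; nothing)
open import Data.Product using (Σ; ∃; _×_; _,_)
open import Data.Sum using (_⊎_)
open import Data.Empty using (⊥)
open import Data.Unit using (⊤)
open import Relation.Nullary using (¬_; yes; no)
open import Relation.Binary.PropositionalEquality using (_≡_; _≢_)

Var : Set
Var = ℕ

data Term : Set where
  var  : Var → Term
  lit  : ℕ → Term
  _⊕_  : Term → Term → Term

data Pure : Set where
  ptrue pfalse : Pure
  _≐_ _≼_      : Term → Term → Pure
  ¬ₚ_          : Pure → Pure
  _∧ₚ_ _∨ₚ_    : Pure → Pure → Pure
  ∃ₚ ∀ₚ        : Var → Pure → Pure

data Spatial : Set where
  Emp  : Spatial
  _↦⟨_,_⟩ : Term → Term → Term → Spatial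
  Arr  : Term → Term → Spatial
  ls   : Term → Term → Spatial
  dll  : Term → Term → Term → Term → Spatial
  _✱_  : Spatial → Spatial → Spatial

record SH : Set where
  constructor _∧ₛ_
  field
    pure    : Pure
    spatial : Spatial
open SH public

-- general formulas (closed under ∧, ∨, *, ∃), used to write the
-- entailments of the proposition literally
data Formula : Set where
  pureF  : Pure → Formula
  spatF  : Spatial → Formula
  _∧F_   : Formula → Formula → Formula
  _∨F_   : Formula → Formula → Formula
  _*F_   : Formula → Formula → Formula
  ∃F     : Var → Formula → Formula

⌜_⌝ : SH → Formula
⌜ Π ∧ₛ S ⌝ = pureF Π ∧F spatF S

⋁ : (n : ℕ) → (Fin n → SH) → Formula
⋁ ℕ.zero ψ = pureF pfalse
⋁ (ℕ.suc ℕ.zero) ψ = ⌜ ψ Fin.zero ⌝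
⋁ (ℕ.suc (ℕ.suc n)) ψ = ⌜ ψ Fin.zero ⌝ ∨F ⋁ (ℕ.suc n) (λ i → ψ (Fin.suc i))

OccT : Var → Term → Set
OccT x (var y) = x ≡ y
OccT x (lit n) = ⊥
OccT x (t ⊕ u) = OccT x t ⊎ OccT x u

OccP : Var → Pure → Set
OccP x ptrue = ⊥
OccP x pfalse = ⊥
OccP x (t ≐ u) = OccT x t ⊎ OccT x u
OccP x (t ≼ u) = OccT x t ⊎ OccT x u
OccP x (¬ₚ P) = OccP x P
OccP x (P ∧ₚ Q) = OccP x P ⊎ OccP x Q
OccP x (P ∨ₚ Q) = OccP x P ⊎ OccP x Q
OccP x (∃ₚ y P) = x ≡ y ⊎ OccP x P
OccP x (∀ₚ y P) = x ≡ y ⊎ OccP x P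

OccS : Var → Spatial → Set
OccS x Emp = ⊥
OccS x (t ↦⟨ u , v ⟩) = OccT x t ⊎ OccT x u ⊎ OccT x v
OccS x (Arr t u) = OccT x t ⊎ OccT x u
OccS x (ls t u) = OccT x t ⊎ OccT x u
OccS x (dll t u v w) = OccT x t ⊎ OccT x u ⊎ OccT x v ⊎ OccT x w
OccS x (S ✱ T) = OccS x S ⊎ OccS x T

OccSH : Var → SH → Set
OccSH x (Π ∧ₛ S) = OccP x Π ⊎ OccS x S

Store : Set
Store = Var → ℕ

_[_≔_] : Store → Var → ℕ → Store
(s [ x ≔ n ]) y with y ≟ x
... | yes _ = n
... | no  _ = s y

⟦_⟧ : Term → Store → ℕ
⟦ var x ⟧ s = s x
⟦ lit n ⟧ s = n
⟦ t ⊕ u ⟧ s = ⟦ t ⟧ s + ⟦ u ⟧ s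

record Heap : Set where
  field
    at     : ℕ → Maybe (ℕ × ℕ)
    at0    : at 0 ≡ nothing
    finite : ∃ λ b → ∀ x → b ≤ x → at x ≡ nothing
open Heap public

_∈Dom_ : ℕ → Heap → Set
x ∈Dom h = ∃ λ v → at h x ≡ just v

EmptyH : Heap → Set
EmptyH h = ∀ x → at h x ≡ nothing

Cell : Heap → ℕ → ℕ → ℕ → Set
Cell h a b c = ∀ x → (x ≡ a → at h x ≡ just (b , c)) × (x ≢ a → at h x ≡ nothing)

Split : Heap → Heap → Heap → Set
Split h h₁ h₂ = ∀ x → (at h x ≡ at h₁ x × at h₂ x ≡ nothing)
                    ⊎ (at h x ≡ at h₂ x × at h₁ x ≡ nothing)

evalP : Store → Pure → Set
evalP s ptrue = ⊤
evalP s pfalse = ⊥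
evalP s (t ≐ u) = ⟦ t ⟧ s ≡ ⟦ u ⟧ s
evalP s (t ≼ u) = ⟦ t ⟧ s ≤ ⟦ u ⟧ s
evalP s (¬ₚ P) = ¬ evalP s P
evalP s (P ∧ₚ Q) = evalP s P × evalP s Q
evalP s (P ∨ₚ Q) = evalP s P ⊎ evalP s Q
evalP s (∃ₚ x P) = ∃ λ n → evalP (s [ x ≔ n ]) P
evalP s (∀ₚ x P) = ∀ n → evalP (s [ x ≔ n ]) P

-- s,h ⊨ ls^k(t,u), with a = s(t), b = s(u)
LsK : ℕ → ℕ → ℕ → Heap → Set
LsK ℕ.zero a b h = ⊥
LsK (ℕ.suc k) a b h =
  (a ≡ b × EmptyH h) ⊎
  (∃ λ z → ∃ λ w → ∃ λ h₁ → ∃ λ h₂ →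
     Split h h₁ h₂ × Cell h₁ a z w × LsK k z b h₂)

-- s,h ⊨ dll^k(t,u,v,w), with a,b,c,d = s(t),s(u),s(v),s(w)
DllK : ℕ → ℕ → ℕ → ℕ → ℕ → Heap → Set
DllK ℕ.zero a b c d h = ⊥
DllK (ℕ.suc k) a b c d h =
  (a ≡ b × c ≡ d × EmptyH h) ⊎
  (∃ λ z → ∃ λ h₁ → ∃ λ h₂ →
     Split h h₁ h₂ × Cell h₁ a z d × DllK k z b c a h₂)

satS : Store → Heap → Spatial → Set
satS s h Emp = EmptyH h
satS s h (t ↦⟨ u , v ⟩) = Cell h (⟦ t ⟧ s) (⟦ u ⟧ s) (⟦ v ⟧ s)
satS s h (Arr t u) = ⟦ t ⟧ s ≤ ⟦ u ⟧ s ×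
  (∀ x → (x ∈Dom h → ⟦ t ⟧ s ≤ x × x ≤ ⟦ u ⟧ s) × (⟦ t ⟧ s ≤ x × x ≤ ⟦ u ⟧ s → x ∈Dom h))
satS s h (ls t u) = ∃ λ k → LsK k (⟦ t ⟧ s) (⟦ u ⟧ s) h
satS s h (dll t u v w) = ∃ λ k → DllK k (⟦ t ⟧ s) (⟦ u ⟧ s) (⟦ v ⟧ s) (⟦ w ⟧ s) h
satS s h (S ✱ T) = ∃ λ h₁ → ∃ λ h₂ → Split h h₁ h₂ × satS s h₁ S × satS s h₂ T

_,_⊨_ : Store → Heap → Formula → Set
s , h ⊨ pureF P = evalP s P
s , h ⊨ spatF S = satS s h S
s , h ⊨ (F ∧F G) = (s , h ⊨ F) × (s , h ⊨ G)
s , h ⊨ (F ∨F G) = (s , h ⊨ F) ⊎ (s , h ⊨ G)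
s , h ⊨ (F *F G) = ∃ λ h₁ → ∃ λ h₂ → Split h h₁ h₂ × (s , h₁ ⊨ F) × (s , h₂ ⊨ G)
s , h ⊨ ∃F x F = ∃ λ n → (s [ x ≔ n ]) , h ⊨ F

_⊫_ : Formula → Formula → Set
F ⊫ G = ∀ (s : Store) (h : Heap) → s , h ⊨ F → s , h ⊨ G

-- (1) ⇒ (2) is immediate, since t = u ∧ Emp and t ↦ (z,y₁) * z ↦ (u,y₂) are
-- both instances of ls(t,u).
--
-- (2) ⇒ (1).  Let s, L + P ⊨ ls(t,u) * φ.  If the segment L is empty, the
-- first premise applies.  Otherwise L runs from a = s(t) to c = s(u), and we
-- replace it by two cells a ↦ (b,0), b ↦ (c,a+1), where b is an address above
-- a, above every address and pointer of the heap and above every anchor of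
-- ψ₁, …, ψₙ; z, y₁, y₂ are set to b, 0, a+1, which t, u, φ, ψᵢ cannot see.
-- The second premise yields some ψᵢ in the new heap g.  The collapse lemma
-- carries ψᵢ back to the original heap: only a points to b, so the only atom
-- of ψᵢ able to cover b is a list segment passing a → b → c (a doubly linked
-- one is excluded because b's back field is a+1), and that segment may run
-- through L instead.
module Submission where

open import Defs
open import Data.Nat using (ℕ; zero; suc; _+_; _⊔_; _≤_; _<_; _≟_; _≤?_; s≤s)
open import Data.Nat.Properties
  using (<-irrefl; ≤-<-trans; ≤-trans; m≤m+n; m≤n+m; n≤1+n; ≤-pred; ≤∧≢⇒<; ≰⇒>;
         m≤m⊔n; m≤n⊔m; m⊔n<o⇒m<o; m⊔n<o⇒n<o; m<n⇒n≢0; >⇒≢; 1+n≢n)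
open import Data.Fin using (Fin)
open import Data.Maybe using (Maybe; just; nothing)
open import Data.Maybe.Properties using (just-injective)
open import Data.Product using (_×_; _,_; ∃; proj₁; proj₂)
open import Data.Sum using (_⊎_; inj₁; inj₂; [_,_]; swap)
open import Data.Empty using (⊥; ⊥-elim)
open import Relation.Nullary using (¬_; Dec; yes; no)
open import Relation.Binary.PropositionalEquality
  using (_≡_; _≢_; refl; sym; trans; cong; cong₂; subst; subst₂; module ≡-Reasoning)
open import Function.Bundles using (_⇔_; mk⇔)

private variable
  h h′ h₁ h₂ h₃ h₄ : Heap
  x : ℕ
  v : ℕ × ℕ

just≢nothing : ∀ {A : Set} {y : A} → just y ≢ nothing
just≢nothing ()

record _⊆ₕ_ (h₁ h₂ : Heap) : Set where
  constructor included
  field within : ∀ x {v} → at h₁ x ≡ just v → at h₂ x ≡ just v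
open _⊆ₕ_

⊆ₕ-refl : h ⊆ₕ h
⊆ₕ-refl = included λ x e → e

⊆ₕ-trans : h₁ ⊆ₕ h₂ → h₂ ⊆ₕ h₃ → h₁ ⊆ₕ h₃
⊆ₕ-trans sub₁₂ sub₂₃ = included λ x e → within sub₂₃ x (within sub₁₂ x e)

alloc≢free : ∀ h {x a v} → at h x ≡ nothing → at h a ≡ just v → a ≢ x
alloc≢free h free alloc refl = just≢nothing (trans (sym alloc) free)

-- The disjoint union h = h₁ + h₂, wrapped in a record so that the three
-- heaps can be inferred from a proof of it.
record Sep (h h₁ h₂ : Heap) : Set where
  constructor sep
  field split : Split h h₁ h₂
open Sep

sep-comm : Sep h h₁ h₂ → Sep h h₂ h₁
sep-comm (sep sp) = sep (λ x → swap (sp x))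

sep-inˡ : Sep h h₁ h₂ → h₁ ⊆ₕ h
sep-inˡ {h} {h₁} (sep sp) = included in-h
  where
  in-h : ∀ x {v} → at h₁ x ≡ just v → at h x ≡ just v
  in-h x e with sp x
  ... | inj₁ (eq , _) = trans eq e
  ... | inj₂ (_ , free) = ⊥-elim (just≢nothing (trans (sym e) free))

sep-inʳ : Sep h h₁ h₂ → h₂ ⊆ₕ h
sep-inʳ sp = sep-inˡ (sep-comm sp)

sep-disjˡ : Sep h h₁ h₂ → at h₁ x ≡ just v → at h₂ x ≡ nothing
sep-disjˡ {x = x} (sep sp) e with sp x
... | inj₁ (_ , free) = free
... | inj₂ (_ , free) = ⊥-elim (just≢nothing (trans (sym e) free))

sep-disjʳ : Sep h h₁ h₂ → at h₂ x ≡ just v → at h₁ x ≡ nothing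
sep-disjʳ sp = sep-disjˡ (sep-comm sp)

sep-cases : Sep h h₁ h₂ → at h x ≡ just v → at h₁ x ≡ just v ⊎ at h₂ x ≡ just v
sep-cases {x = x} (sep sp) e with sp x
... | inj₁ (eq , _) = inj₁ (trans (sym eq) e)
... | inj₂ (eq , _) = inj₂ (trans (sym eq) e)

sep-outsideˡ : Sep h h₁ h₂ → at h₁ x ≡ nothing → at h x ≡ at h₂ x
sep-outsideˡ {x = x} (sep sp) free with sp x
... | inj₁ (eq , free₂) = trans eq (trans free (sym free₂))
... | inj₂ (eq , _) = eq

sep-outsideʳ : Sep h h₁ h₂ → at h₂ x ≡ nothing → at h x ≡ at h₁ x
sep-outsideʳ sp = sep-outsideˡ (sep-comm sp)

sep-free : Sep h h₁ h₂ → at h x ≡ nothing → at h₁ x ≡ nothing × at h₂ x ≡ nothing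
sep-free {x = x} (sep sp) free with sp x
... | inj₁ (eq , free₂) = trans (sym eq) free , free₂
... | inj₂ (eq , free₁) = free₁ , trans (sym eq) free

cell-at : ∀ h a {p q} → Cell h a p q → at h a ≡ just (p , q)
cell-at h a c = proj₁ (c a) refl

cell-other : ∀ h a {p q x} → Cell h a p q → x ≢ a → at h x ≡ nothing
cell-other h a {x = x} c = proj₂ (c x)

cell-dom : ∀ h a {p q x v} → Cell h a p q → at h x ≡ just v → x ≡ a
cell-dom h a {x = x} c e with x ≟ a
... | yes x≡a = x≡a
... | no x≢a = ⊥-elim (just≢nothing (trans (sym e) (cell-other h a c x≢a)))

cell-cong : ∀ h {a a′ p p′ q q′} → a ≡ a′ → p ≡ p′ → q ≡ q′ → Cell h a p q → Cell h a′ p′ q′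
cell-cong h refl refl refl cl = cl

sep-cell-rest : ∀ {h h₁ h₂} x {y v p q} → Sep h h₁ h₂ → Cell h₁ x p q → y ≢ x → at h y ≡ just v → at h₂ y ≡ just v
sep-cell-rest {h₁ = h₁} x parts cl y≢x e with sep-cases parts e
... | inj₁ e₁ = ⊥-elim (y≢x (cell-dom h₁ x cl e₁))
... | inj₂ e₂ = e₂

emptyH : Heap
emptyH = record { at = λ _ → nothing ; at0 = refl ; finite = 0 , λ _ _ → refl }

sep-emptyʳ : Sep h h emptyH
sep-emptyʳ = sep λ x → inj₁ (refl , refl)

private
  hide : Maybe (ℕ × ℕ) → Maybe (ℕ × ℕ) → Maybe (ℕ × ℕ)
  hide (just _) _ = nothing
  hide nothing m = m

  hide-free : ∀ d {m} → m ≡ nothing → hide d m ≡ nothing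
  hide-free (just _) _ = refl
  hide-free nothing free = free

_∖_ : Heap → Heap → Heap
h ∖ D = record
  { at = λ x → hide (at D x) (at h x)
  ; at0 = hide-free (at D 0) (at0 h)
  ; finite = proj₁ (finite h) , λ x le → hide-free (at D x) (proj₂ (finite h) x le)
  }

∖-outside : ∀ h D {x} → at D x ≡ nothing → at (h ∖ D) x ≡ at h x
∖-outside h D free rewrite free = refl

∖-split : ∀ {h D} → D ⊆ₕ h → Sep h (h ∖ D) D
∖-split {h} {D} sub = sep split′
  where
  split′ : Split h (h ∖ D) D
  split′ x with at D x in e
  ... | just _ = inj₂ (within sub x e , refl)
  ... | nothing = inj₁ (refl , refl)

∖-assoc : ∀ {h A B C D} → Sep h A B → Sep B C D → Sep (h ∖ D) A C
∖-assoc {h} {A} {B} {C} {D} spAB spCD = sep split′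
  where
  split′ : Split (h ∖ D) A C
  split′ x with at D x in eD
  ... | just _ = inj₁ (sym (sep-disjʳ spAB (within (sep-inʳ spCD) x eD)) , sep-disjʳ spCD eD)
  ... | nothing with split spAB x
  ...   | inj₁ (eq , freeB) = inj₁ (eq , trans (sym (sep-outsideʳ spCD eD)) freeB)
  ...   | inj₂ (eq , freeA) = inj₂ (trans eq (sep-outsideʳ spCD eD) , freeA)

extend : (Q : Heap) (a : ℕ) → ℕ × ℕ → a ≢ 0 → Heap
extend Q a v a≢0 = record { at = f ; at0 = f0 ; finite = suc a + proj₁ (finite Q) , beyond }
  where
  f : ℕ → Maybe (ℕ × ℕ)
  f x with x ≟ a
  ... | yes _ = just v
  ... | no _ = at Q x
  f0 : f 0 ≡ nothing
  f0 with 0 ≟ a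
  ... | yes 0≡a = ⊥-elim (a≢0 (sym 0≡a))
  ... | no _ = at0 Q
  beyond : ∀ x → suc a + proj₁ (finite Q) ≤ x → f x ≡ nothing
  beyond x le with x ≟ a
  ... | yes refl = ⊥-elim (<-irrefl refl (≤-trans (m≤m+n (suc x) _) le))
  ... | no _ = proj₂ (finite Q) x (≤-trans (m≤n+m _ (suc a)) le)

extend-here : ∀ Q a v a≢0 → at (extend Q a v a≢0) a ≡ just v
extend-here Q a v a≢0 with a ≟ a
... | yes _ = refl
... | no a≢a = ⊥-elim (a≢a refl)

extend-there : ∀ Q a v a≢0 {x} → x ≢ a → at (extend Q a v a≢0) x ≡ at Q x
extend-there Q a v a≢0 {x} x≢a with x ≟ a
... | yes x≡a = ⊥-elim (x≢a x≡a)
... | no _ = refl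

cellH : (a : ℕ) → ℕ × ℕ → a ≢ 0 → Heap
cellH = extend emptyH

cellH-cell : ∀ a p q a≢0 → Cell (cellH a (p , q) a≢0) a p q
cellH-cell a p q a≢0 x =
  (λ { refl → extend-here emptyH a (p , q) a≢0 }) , extend-there emptyH a (p , q) a≢0

extend-sep : ∀ Q a v a≢0 → at Q a ≡ nothing → Sep (extend Q a v a≢0) (cellH a v a≢0) Q
extend-sep Q a v a≢0 free = sep split′
  where
  split′ : Split (extend Q a v a≢0) (cellH a v a≢0) Q
  split′ x = by-cases (x ≟ a)
    where
    by-cases : Dec (x ≡ a) → (at (extend Q a v a≢0) x ≡ at (cellH a v a≢0) x × at Q x ≡ nothing)
                             ⊎ (at (extend Q a v a≢0) x ≡ at Q x × at (cellH a v a≢0) x ≡ nothing)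
    by-cases (yes refl) = inj₁ (trans (extend-here Q a v a≢0) (sym (extend-here emptyH a v a≢0)) , free)
    by-cases (no x≢a) = inj₂ (extend-there Q a v a≢0 x≢a , extend-there emptyH a v a≢0 x≢a)

-- Pointwise equality of heaps; heaps carry proofs, so all predicates are
-- transported along it explicitly.
record _≗ₕ_ (h h′ : Heap) : Set where
  constructor pointwise
  field at-≡ : ∀ x → at h x ≡ at h′ x
open _≗ₕ_

split-resp : ∀ h₁ h₂ → h ≗ₕ h′ → Split h h₁ h₂ → Split h′ h₁ h₂
split-resp h₁ h₂ eq sp x with sp x
... | inj₁ (e , free) = inj₁ (trans (sym (at-≡ eq x)) e , free)
... | inj₂ (e , free) = inj₂ (trans (sym (at-≡ eq x)) e , free)

empty-resp : h ≗ₕ h′ → EmptyH h → EmptyH h′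
empty-resp eq emp x = trans (sym (at-≡ eq x)) (emp x)

ls-resp : ∀ k {a b} → h ≗ₕ h′ → LsK k a b h → LsK k a b h′
ls-resp (suc k) eq (inj₁ (e , emp)) = inj₁ (e , empty-resp eq emp)
ls-resp (suc k) eq (inj₂ (z , w , h₁ , h₂ , sp , cl , l)) =
  inj₂ (z , w , h₁ , h₂ , split-resp h₁ h₂ eq sp , cl , l)

dll-resp : ∀ k {a b c d} → h ≗ₕ h′ → DllK k a b c d h → DllK k a b c d h′
dll-resp (suc k) eq (inj₁ (e , e′ , emp)) = inj₁ (e , e′ , empty-resp eq emp)
dll-resp (suc k) eq (inj₂ (z , h₁ , h₂ , sp , cl , l)) = inj₂ (z , h₁ , h₂ , split-resp h₁ h₂ eq sp , cl , l)

satS-resp : ∀ s S → h ≗ₕ h′ → satS s h S → satS s h′ S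
satS-resp s Emp eq emp = empty-resp eq emp
satS-resp s (t ↦⟨ u , w ⟩) eq c x =
  (λ e → trans (sym (at-≡ eq x)) (proj₁ (c x) e)) , (λ ne → trans (sym (at-≡ eq x)) (proj₂ (c x) ne))
satS-resp s (Arr t u) eq (le , dom) = le , λ x →
  (λ { (v , e) → proj₁ (dom x) (v , trans (at-≡ eq x) e) }) ,
  (λ r → let (v , e) = proj₂ (dom x) r in v , trans (sym (at-≡ eq x)) e)
satS-resp s (ls t u) eq (k , l) = k , ls-resp k eq l
satS-resp s (dll t u v w) eq (k , l) = k , dll-resp k eq l
satS-resp s (S ✱ T) eq (h₁ , h₂ , sp , sat₁ , sat₂) = h₁ , h₂ , split-resp h₁ h₂ eq sp , sat₁ , sat₂

ls-concat : ∀ k₁ {k₂} a c b {L₁ L₂ h} → LsK k₁ a c L₁ → LsK k₂ c b L₂ → Sep h L₁ L₂ → ∃ λ k → LsK k a b h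
ls-concat (suc k₁) {k₂} a c b (inj₁ (refl , emp)) l₂ sp =
  k₂ , ls-resp k₂ (pointwise λ x → sym (sep-outsideˡ sp (emp x))) l₂
ls-concat (suc k₁) a c b {L₁} {h = h} (inj₂ (n , w , h₁ , h₂ , sp₁ , cl , l₁)) l₂ sp =
  suc (proj₁ tail) , inj₂ (n , w , h₁ , h ∖ h₁ , split (sep-comm (∖-split {h} {h₁} h₁⊆h)) , cl , proj₂ tail)
  where
  head : Sep L₁ h₁ h₂
  head = sep sp₁
  h₁⊆h : h₁ ⊆ₕ h
  h₁⊆h = ⊆ₕ-trans (sep-inˡ head) (sep-inˡ sp)
  -- the rest of h is the tail h₂ of the first segment followed by L₂
  tail : ∃ λ k → LsK k n b (h ∖ h₁)
  tail = ls-concat k₁ n c b l₁ l₂ (sep-comm (∖-assoc (sep-comm sp) (sep-comm head)))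

ls-cases : ∀ k {a c L} → LsK k a c L → (a ≡ c × EmptyH L) ⊎ a ∈Dom L
ls-cases (suc k) (inj₁ empty) = inj₁ empty
ls-cases (suc k) {a} {L = L} (inj₂ (n , w , L₁ , L₂ , sp , cl , _)) =
  inj₂ ((n , w) , within (sep-inˡ (sep {L} {L₁} {L₂} sp)) a (cell-at L₁ a cl))

two-cells-ls : ∀ {a b c w w′} → Sep h h₁ h₂ → Cell h₁ a b w → Cell h₂ b c w′ → LsK 3 a c h
two-cells-ls {h₁ = h₁} {h₂ = h₂} {b = b} {c = c} {w = w} {w′ = w′} parts cl₁ cl₂ =
  inj₂ (b , w , h₁ , h₂ , split parts , cl₁ ,
    inj₂ (c , w′ , h₂ , emptyH , split (sep-emptyʳ {h₂}) , cl₂ , inj₁ (refl , λ _ → refl)))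

update-same : ∀ (s : Store) x n → (s [ x ≔ n ]) x ≡ n
update-same s x n with x ≟ x
... | yes _ = refl
... | no x≢x = ⊥-elim (x≢x refl)

update-other : ∀ (s : Store) x n {y} → y ≢ x → (s [ x ≔ n ]) y ≡ s y
update-other s x n {y} y≢x with y ≟ x
... | yes y≡x = ⊥-elim (y≢x y≡x)
... | no _ = refl

Agree : (Var → Set) → Store → Store → Set
Agree Occ s s′ = ∀ x → Occ x → s x ≡ s′ x

update-agree : ∀ {Occ s s′} y n → Agree (λ x → x ≡ y ⊎ Occ x) s s′ → Agree Occ (s [ y ≔ n ]) (s′ [ y ≔ n ])
update-agree y n ag x occ with x ≟ y
... | yes _ = refl
... | no _ = ag x (inj₂ occ)

term-agree : ∀ t {s s′} → Agree (λ x → OccT x t) s s′ → ⟦ t ⟧ s ≡ ⟦ t ⟧ s′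
term-agree (var x) ag = ag x refl
term-agree (lit n) ag = refl
term-agree (t ⊕ u) ag = cong₂ _+_ (term-agree t (λ x o → ag x (inj₁ o))) (term-agree u (λ x o → ag x (inj₂ o)))

pure-agree : ∀ P {s s′} → Agree (λ x → OccP x P) s s′ → evalP s P → evalP s′ P
pure-agree ptrue ag holds = holds
pure-agree pfalse ag holds = holds
pure-agree (t ≐ u) ag holds =
  trans (sym (term-agree t (λ x o → ag x (inj₁ o)))) (trans holds (term-agree u (λ x o → ag x (inj₂ o))))
pure-agree (t ≼ u) ag holds =
  subst₂ _≤_ (term-agree t (λ x o → ag x (inj₁ o))) (term-agree u (λ x o → ag x (inj₂ o))) holds
pure-agree (¬ₚ P) ag holds = λ p → holds (pure-agree P (λ x o → sym (ag x o)) p)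
pure-agree (P ∧ₚ Q) ag (p , q) = pure-agree P (λ x o → ag x (inj₁ o)) p , pure-agree Q (λ x o → ag x (inj₂ o)) q
pure-agree (P ∨ₚ Q) ag (inj₁ p) = inj₁ (pure-agree P (λ x o → ag x (inj₁ o)) p)
pure-agree (P ∨ₚ Q) ag (inj₂ q) = inj₂ (pure-agree Q (λ x o → ag x (inj₂ o)) q)
pure-agree (∃ₚ y P) ag (n , p) = n , pure-agree P (update-agree y n ag) p
pure-agree (∀ₚ y P) ag p = λ n → pure-agree P (update-agree y n ag) (p n)

spatial-agree : ∀ S {s s′ h} → Agree (λ x → OccS x S) s s′ → satS s h S → satS s′ h S
spatial-agree Emp ag emp = emp
spatial-agree (t ↦⟨ u , v ⟩) ag c
  rewrite term-agree t (λ x o → ag x (inj₁ o))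
        | term-agree u (λ x o → ag x (inj₂ (inj₁ o)))
        | term-agree v (λ x o → ag x (inj₂ (inj₂ o))) = c
spatial-agree (Arr t u) ag arr
  rewrite term-agree t (λ x o → ag x (inj₁ o))
        | term-agree u (λ x o → ag x (inj₂ o)) = arr
spatial-agree (ls t u) ag l
  rewrite term-agree t (λ x o → ag x (inj₁ o))
        | term-agree u (λ x o → ag x (inj₂ o)) = l
spatial-agree (dll t u v w) ag d
  rewrite term-agree t (λ x o → ag x (inj₁ o))
        | term-agree u (λ x o → ag x (inj₂ (inj₁ o)))
        | term-agree v (λ x o → ag x (inj₂ (inj₂ (inj₁ o))))
        | term-agree w (λ x o → ag x (inj₂ (inj₂ (inj₂ o)))) = d
spatial-agree (S ✱ T) ag (h₁ , h₂ , sp , sat₁ , sat₂) =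
  h₁ , h₂ , sp , spatial-agree S (λ x o → ag x (inj₁ o)) sat₁ , spatial-agree T (λ x o → ag x (inj₂ o)) sat₂

sh-agree : ∀ φ {s s′ h} → Agree (λ x → OccSH x φ) s s′ → s , h ⊨ ⌜ φ ⌝ → s′ , h ⊨ ⌜ φ ⌝
sh-agree φ ag (π , σ) =
  pure-agree (pure φ) (λ x o → ag x (inj₁ o)) π , spatial-agree (spatial φ) (λ x o → ag x (inj₂ o)) σ

⋁-map : ∀ n (ψ : Fin n → SH) {s h s′ h′} →
  (∀ i → s , h ⊨ ⌜ ψ i ⌝ → s′ , h′ ⊨ ⌜ ψ i ⌝) → s , h ⊨ ⋁ n ψ → s′ , h′ ⊨ ⋁ n ψ
⋁-map zero ψ f ()
⋁-map (suc zero) ψ f sat = f Fin.zero sat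
⋁-map (suc (suc n)) ψ f (inj₁ sat) = inj₁ (f Fin.zero sat)
⋁-map (suc (suc n)) ψ f (inj₂ sat) = inj₂ (⋁-map (suc n) (λ i → ψ (Fin.suc i)) (λ i → f (Fin.suc i)) sat)

private
  next : Maybe (ℕ × ℕ) → ℕ
  next (just (p , _)) = p
  next nothing = 0

nextSum : Heap → ℕ → ℕ
nextSum h zero = 0
nextSum h (suc m) = nextSum h m + next (at h m)

nextSum-bound : ∀ h m {x p q} → x < m → at h x ≡ just (p , q) → p ≤ nextSum h m
nextSum-bound h (suc m) {x} x<1+m e with x ≟ m
... | yes refl rewrite e = m≤n+m _ (nextSum h x)
... | no x≢m = ≤-trans (nextSum-bound h m (≤∧≢⇒< (≤-pred x<1+m) x≢m) e) (m≤m+n _ _)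

record FreshAbove (h : Heap) (m : ℕ) : Set where
  field
    address     : ℕ
    above       : m < address
    unallocated : at h address ≡ nothing
    unpointed   : ∀ x {p q} → at h x ≡ just (p , q) → p < address

-- Such an address exists: exceed m, the domain bound of h, and the sum of
-- all pointers stored in h.
fresh-address : ∀ h m → FreshAbove h m
fresh-address h m = record
  { address = b ; above = m<b ; unallocated = proj₂ (finite h) b bound≤b ; unpointed = targets }
  where
  bound = proj₁ (finite h)
  b = suc (m + bound + nextSum h bound)
  m<b : m < b
  m<b = s≤s (≤-trans (m≤m+n m bound) (m≤m+n _ _))
  bound≤b : bound ≤ b
  bound≤b = ≤-trans (≤-trans (m≤n+m bound m) (m≤m+n _ _)) (n≤1+n _)
  targets : ∀ x {p q} → at h x ≡ just (p , q) → p < b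
  targets x e = s≤s (≤-trans (nextSum-bound h bound x<bound e) (m≤n+m _ _))
    where
    x<bound : x < bound
    x<bound with bound ≤? x
    ... | yes bound≤x = ⊥-elim (just≢nothing (trans (sym e) (proj₂ (finite h) x bound≤x)))
    ... | no bound≰x = ≰⇒> bound≰x

anchor : Store → Spatial → ℕ
anchor s Emp = 0
anchor s (t ↦⟨ _ , _ ⟩) = ⟦ t ⟧ s
anchor s (Arr _ u) = ⟦ u ⟧ s
anchor s (ls t _) = ⟦ t ⟧ s
anchor s (dll t _ _ _) = ⟦ t ⟧ s
anchor s (S ✱ T) = anchor s S ⊔ anchor s T

anchors : Store → (n : ℕ) → (Fin n → SH) → ℕ
anchors s zero ψ = 0
anchors s (suc n) ψ = anchor s (spatial (ψ Fin.zero)) ⊔ anchors s n (λ i → ψ (Fin.suc i))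

anchors-bound : ∀ s n ψ i → anchor s (spatial (ψ i)) ≤ anchors s n ψ
anchors-bound s (suc n) ψ Fin.zero = m≤m⊔n _ _
anchors-bound s (suc n) ψ (Fin.suc i) = ≤-trans (anchors-bound s n (λ j → ψ (Fin.suc j)) i) (m≤n⊔m _ _)

-- A spatial formula all of whose anchors lie below b and
-- that holds in a part of g containing a and b still holds after the two
-- cells are replaced by L: the path a → b → c can only be covered by an ls atom,
-- which then runs through L instead.
module Collapse (s : Store) (a b c w₁ w₂ : ℕ) (g L : Heap)
  (g-a : at g a ≡ just (b , w₁))
  (g-b : at g b ≡ just (c , w₂))
  (b≢a : b ≢ a)
  (w₂≢a : w₂ ≢ a)
  (only-a→b : ∀ x {p q} → x ≢ a → x ≢ b → at g x ≡ just (p , q) → p ≢ b)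
  (L-a : a ∈Dom L)
  (L-b : at L b ≡ nothing)
  (L-disj : ∀ x {v} → x ≢ a → x ≢ b → at g x ≡ just v → at L x ≡ nothing)
  {kL : ℕ} (L-ls : LsK kL a c L)
  where

  record Replaces (h h′ : Heap) : Set where
    field
      keeps-L : L ⊆ₕ h′
      agrees  : ∀ x → at L x ≡ nothing → x ≢ b → at h′ x ≡ at h x
      drops-b : at h′ b ≡ nothing
  open Replaces

  unreachable-ls : ∀ k {x y} → h ⊆ₕ g → b ∈Dom h → at h a ≡ nothing → x ≢ b → ¬ LsK k x y h
  unreachable-ls (suc k) _ (_ , h-b) _ _ (inj₁ (_ , emp)) = just≢nothing (trans (sym h-b) (emp b))
  unreachable-ls {h = h} (suc k) {x} sub (v , h-b) h-a x≢b (inj₂ (n , w , h₁ , h₂ , sp , cl , rest)) =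
    unreachable-ls k (⊆ₕ-trans (sep-inʳ parts) sub) (v , sep-cell-rest x parts cl (λ e → x≢b (sym e)) h-b)
      (proj₂ (sep-free parts h-a)) n≢b rest
    where
    parts : Sep h h₁ h₂
    parts = sep sp
    h-x : at h x ≡ just (n , w)
    h-x = within (sep-inˡ parts) x (cell-at h₁ x cl)
    n≢b : n ≢ b
    n≢b = only-a→b x (alloc≢free h h-a h-x) x≢b (within sub x h-x)

  -- A doubly linked segment in g that does not start at b, or whose back
  -- pointer is not w₂, never reaches b: it could only enter b from a, and then
  -- the back field w₂ of b would have to be a.
  unreachable-dll : ∀ k {x y l p} → h ⊆ₕ g → b ∈Dom h → (x ≢ b ⊎ p ≢ w₂) → ¬ DllK k x y l p h
  unreachable-dll (suc k) _ (_ , h-b) _ (inj₁ (_ , _ , emp)) = just≢nothing (trans (sym h-b) (emp b))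
  unreachable-dll {h = h} (suc k) {x} {p = p} sub (v , h-b) start (inj₂ (n , h₁ , h₂ , sp , cl , rest)) =
    by-cases (x ≟ b)
    where
    parts : Sep h h₁ h₂
    parts = sep sp
    g-x : at g x ≡ just (n , p)
    g-x = within sub x (within (sep-inˡ parts) x (cell-at h₁ x cl))
    by-cases : Dec (x ≡ b) → ⊥
    by-cases (yes x≡b) = [ (λ x≢b → x≢b x≡b) , (λ p≢w₂ → p≢w₂ p≡w₂) ] start
      where
      p≡w₂ : p ≡ w₂
      p≡w₂ = cong proj₂ (just-injective (trans (sym g-x) (subst (λ m → at g m ≡ just (c , w₂)) (sym x≡b) g-b)))
    by-cases (no x≢b) = unreachable-dll k (⊆ₕ-trans (sep-inʳ parts) sub)
      (v , sep-cell-rest x parts cl (λ e → x≢b (sym e)) h-b) next-start rest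
      where
      next-start : n ≢ b ⊎ x ≢ w₂
      next-start with x ≟ a
      ... | yes x≡a = inj₂ (λ x≡w₂ → w₂≢a (trans (sym x≡w₂) x≡a))
      ... | no x≢a = inj₁ (only-a→b x x≢a x≢b g-x)

  unreachable : ∀ S → anchor s S < b → h ⊆ₕ g → b ∈Dom h → at h a ≡ nothing → ¬ satS s h S
  unreachable Emp _ _ (_ , h-b) _ emp = just≢nothing (trans (sym h-b) (emp b))
  unreachable {h} (t ↦⟨ _ , _ ⟩) t<b _ (_ , h-b) _ cl = <-irrefl (sym (cell-dom h (⟦ t ⟧ s) cl h-b)) t<b
  unreachable (Arr _ _) u<b _ (_ , h-b) _ (_ , dom) = <-irrefl refl (≤-<-trans (proj₂ (proj₁ (dom b) (_ , h-b))) u<b)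
  unreachable (ls _ _) t<b sub h-b h-a (k , l) = unreachable-ls k sub h-b h-a (λ t≡b → <-irrefl t≡b t<b) l
  unreachable (dll _ _ _ _) t<b sub h-b _ (k , d) = unreachable-dll k sub h-b (inj₁ (λ t≡b → <-irrefl t≡b t<b)) d
  unreachable {h} (S ✱ T) lt sub (v , h-b) h-a (h₁ , h₂ , sp , sat₁ , sat₂) = in-one-part (sep-cases parts h-b)
    where
    parts : Sep h h₁ h₂
    parts = sep sp
    in-one-part : at h₁ b ≡ just v ⊎ at h₂ b ≡ just v → ⊥
    in-one-part (inj₁ b₁) = unreachable S (m⊔n<o⇒m<o _ _ lt) (⊆ₕ-trans (sep-inˡ parts) sub) (v , b₁)
                              (proj₁ (sep-free parts h-a)) sat₁
    in-one-part (inj₂ b₂) = unreachable T (m⊔n<o⇒n<o _ _ lt) (⊆ₕ-trans (sep-inʳ parts) sub) (v , b₂)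
                              (proj₂ (sep-free parts h-a)) sat₂

  frame : Sep h h₁ h₂ → h ⊆ₕ g → at h₂ a ≡ nothing → at h₂ b ≡ nothing → Replaces h h′
        → Replaces h₁ (h′ ∖ h₂) × Sep h′ (h′ ∖ h₂) h₂
  frame {h} {h₁} {h₂} {h′} parts sub h₂-a h₂-b R = replaces₁ , ∖-split (included h₂⊆h′)
    where
    h₂-outside-L : ∀ x {v} → at h₂ x ≡ just v → at L x ≡ nothing
    h₂-outside-L x e =
      L-disj x (alloc≢free h₂ h₂-a e) (alloc≢free h₂ h₂-b e) (within sub x (within (sep-inʳ parts) x e))
    L-outside-h₂ : ∀ x {v} → at L x ≡ just v → at h₂ x ≡ nothing
    L-outside-h₂ x eL with at h₂ x in e₂
    ... | just _ = ⊥-elim (just≢nothing (trans (sym eL) (h₂-outside-L x e₂)))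
    ... | nothing = refl
    h₂⊆h′ : ∀ x {v} → at h₂ x ≡ just v → at h′ x ≡ just v
    h₂⊆h′ x e = trans (agrees R x (h₂-outside-L x e) (alloc≢free h₂ h₂-b e)) (within (sep-inʳ parts) x e)
    replaces₁ : Replaces h₁ (h′ ∖ h₂)
    keeps-L replaces₁ = included λ x eL → trans (∖-outside h′ h₂ (L-outside-h₂ x eL)) (within (keeps-L R) x eL)
    agrees replaces₁ x eL x≢b with at h₂ x in e₂
    ... | just _ = sym (sep-disjʳ parts e₂)
    ... | nothing = trans (agrees R x eL x≢b) (sep-outsideʳ parts e₂)
    drops-b replaces₁ = trans (∖-outside h′ h₂ h₂-b) (drops-b R)

  splice : ∀ {p₁ q₁ p₃ q₃} → Sep h h₁ h₂ → Sep h₂ h₃ h₄ → Cell h₁ a p₁ q₁ → Cell h₃ b p₃ q₃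
         → h ⊆ₕ g → Replaces h h′ → Sep h′ L h₄
  splice {h} {h₁} {h₂} {h₃} {h₄} {h′} parts rest cl-a cl-b sub R = sep split′
    where
    h₄-a : at h₄ a ≡ nothing
    h₄-a = proj₂ (sep-free rest (sep-disjˡ parts (cell-at h₁ a cl-a)))
    h₄-b : at h₄ b ≡ nothing
    h₄-b = sep-disjˡ rest (cell-at h₃ b cl-b)
    L-outside-h₄ : ∀ x {v} → at L x ≡ just v → at h₄ x ≡ nothing
    L-outside-h₄ x eL with at h₄ x in e₄
    ... | nothing = refl
    ... | just _ = ⊥-elim (just≢nothing (trans (sym eL)
            (L-disj x (alloc≢free h₄ h₄-a e₄) (alloc≢free h₄ h₄-b e₄)
              (within sub x (within (sep-inʳ parts) x (within (sep-inʳ rest) x e₄))))))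
    outside-L : ∀ x → at L x ≡ nothing → Dec (x ≡ b) → at h′ x ≡ at h₄ x
    outside-L x _ (yes refl) = trans (drops-b R) (sym h₄-b)
    outside-L x L-x (no x≢b) = begin
      at h′ x  ≡⟨ agrees R x L-x x≢b ⟩
      at h x   ≡⟨ sep-outsideˡ parts (cell-other h₁ a cl-a x≢a) ⟩
      at h₂ x  ≡⟨ sep-outsideˡ rest (cell-other h₃ b cl-b x≢b) ⟩
      at h₄ x  ∎
      where
      open ≡-Reasoning
      x≢a : x ≢ a
      x≢a x≡a = alloc≢free L L-x (proj₂ L-a) (sym x≡a)
    split′ : Split h′ L h₄
    split′ x with at L x in eL
    ... | just _ = inj₁ (within (keeps-L R) x eL , L-outside-h₄ x eL)
    ... | nothing = inj₂ (outside-L x eL (x ≟ b) , refl)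

  -- An ls atom starting at a runs a → b → c and then continues in the rest of
  -- the heap; after the replacement it runs through L instead.
  collapse-from-a : ∀ k {y} → h ⊆ₕ g → b ∈Dom h → Replaces h h′ → LsK k a y h → ∃ λ k′ → LsK k′ a y h′
  collapse-from-a (suc k) _ (_ , h-b) _ (inj₁ (_ , emp)) = ⊥-elim (just≢nothing (trans (sym h-b) (emp b)))
  collapse-from-a {h} {h′} (suc k) {y} sub (v , h-b) R (inj₂ (n , w , h₁ , h₂ , sp , cl , rest)) =
    through-b k (subst (λ m → LsK k m y h₂) n≡b rest)
    where
    parts : Sep h h₁ h₂
    parts = sep sp
    n≡b : n ≡ b
    n≡b = cong proj₁ (just-injective (trans (sym (within sub a (within (sep-inˡ parts) a (cell-at h₁ a cl)))) g-a))
    h₂-b : at h₂ b ≡ just v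
    h₂-b = sep-cell-rest a parts cl b≢a h-b
    through-b : ∀ k → LsK k b y h₂ → ∃ λ k′ → LsK k′ a y h′
    through-b (suc k) (inj₁ (_ , emp)) = ⊥-elim (just≢nothing (trans (sym h₂-b) (emp b)))
    through-b (suc k) (inj₂ (n₂ , q , h₃ , h₄ , sp₂ , cl₂ , rest₂)) =
      ls-concat kL a c y L-ls (subst (λ m → LsK k m y h₄) n₂≡c rest₂) (splice parts parts₂ cl cl₂ sub R)
      where
      parts₂ : Sep h₂ h₃ h₄
      parts₂ = sep sp₂
      n₂≡c : n₂ ≡ c
      n₂≡c = cong proj₁ (just-injective (trans
        (sym (within sub b (within (sep-inʳ parts) b (within (sep-inˡ parts₂) b (cell-at h₃ b cl₂))))) g-b))

  -- An ls atom covering a and b (and not starting at b) is still an ls atom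
  -- after the replacement: cells before a are framed off one at a time.
  collapse-ls : ∀ k {x y} → h ⊆ₕ g → a ∈Dom h → b ∈Dom h → x ≢ b → Replaces h h′ → LsK k x y h
              → ∃ λ k′ → LsK k′ x y h′
  collapse-ls (suc k) _ (_ , h-a) _ _ _ (inj₁ (_ , emp)) = ⊥-elim (just≢nothing (trans (sym h-a) (emp a)))
  collapse-ls {h} {h′} (suc k) {x} {y} sub h-a h-b x≢b R l@(inj₂ (n , w , h₁ , h₂ , sp , cl , rest)) with x ≟ a
  ... | yes refl = collapse-from-a (suc k) sub h-b R l
  ... | no x≢a = suc (proj₁ ih) , inj₂ (n , w , h₁ , h′ ∖ h₁ , split (sep-comm (proj₂ framing)) , cl , proj₂ ih)
    where
    parts : Sep h h₁ h₂
    parts = sep sp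
    a≢x : a ≢ x
    a≢x a≡x = x≢a (sym a≡x)
    b≢x : b ≢ x
    b≢x b≡x = x≢b (sym b≡x)
    framing : Replaces h₂ (h′ ∖ h₁) × Sep h′ (h′ ∖ h₁) h₁
    framing = frame (sep-comm parts) sub (cell-other h₁ x cl a≢x) (cell-other h₁ x cl b≢x) R
    n≢b : n ≢ b
    n≢b = only-a→b x x≢a x≢b (within sub x (within (sep-inˡ parts) x (cell-at h₁ x cl)))
    ih : ∃ λ k′ → LsK k′ n y (h′ ∖ h₁)
    ih = collapse-ls k (⊆ₕ-trans (sep-inʳ parts) sub)
           (proj₁ h-a , sep-cell-rest x parts cl a≢x (proj₂ h-a))
           (proj₁ h-b , sep-cell-rest x parts cl b≢x (proj₂ h-b)) n≢b (proj₁ framing) rest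

  collapse : ∀ S → anchor s S < b → h ⊆ₕ g → a ∈Dom h → b ∈Dom h → Replaces h h′ → satS s h S → satS s h′ S
  collapse Emp _ _ (_ , h-a) _ _ emp = ⊥-elim (just≢nothing (trans (sym h-a) (emp a)))
  collapse {h} (t ↦⟨ _ , _ ⟩) _ _ (_ , h-a) (_ , h-b) _ cl =
    ⊥-elim (b≢a (trans (cell-dom h (⟦ t ⟧ s) cl h-b) (sym (cell-dom h (⟦ t ⟧ s) cl h-a))))
  collapse (Arr _ _) u<b _ _ (_ , h-b) _ (_ , dom) =
    ⊥-elim (<-irrefl refl (≤-<-trans (proj₂ (proj₁ (dom b) (_ , h-b))) u<b))
  collapse (ls _ _) t<b sub h-a h-b R (k , l) = collapse-ls k sub h-a h-b (λ t≡b → <-irrefl t≡b t<b) R l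
  collapse (dll _ _ _ _) t<b sub _ h-b _ (k , d) =
    ⊥-elim (unreachable-dll k sub h-b (inj₁ (λ t≡b → <-irrefl t≡b t<b)) d)
  collapse {h} {h′} (S ✱ T) lt sub (v , h-a) (w , h-b) R (h₁ , h₂ , sp , sat₁ , sat₂) =
    by-parts (sep-cases parts h-a) (sep-cases parts h-b)
    where
    parts : Sep h h₁ h₂
    parts = sep sp
    S<b : anchor s S < b
    S<b = m⊔n<o⇒m<o _ _ lt
    T<b : anchor s T < b
    T<b = m⊔n<o⇒n<o _ _ lt
    -- a and b lie in the same part, since the other part could not reach b
    by-parts : at h₁ a ≡ just v ⊎ at h₂ a ≡ just v → at h₁ b ≡ just w ⊎ at h₂ b ≡ just w → satS s h′ (S ✱ T)
    by-parts (inj₁ a₁) (inj₁ b₁) =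
      let (R₁ , parts′) = frame parts sub (sep-disjˡ parts a₁) (sep-disjˡ parts b₁) R in
      h′ ∖ h₂ , h₂ , split parts′ ,
      collapse S S<b (⊆ₕ-trans (sep-inˡ parts) sub) (v , a₁) (w , b₁) R₁ sat₁ , sat₂
    by-parts (inj₂ a₂) (inj₂ b₂) =
      let (R₂ , parts′) = frame (sep-comm parts) sub (sep-disjʳ parts a₂) (sep-disjʳ parts b₂) R in
      h₁ , h′ ∖ h₁ , split (sep-comm parts′) ,
      sat₁ , collapse T T<b (⊆ₕ-trans (sep-inʳ parts) sub) (v , a₂) (w , b₂) R₂ sat₂
    by-parts (inj₁ a₁) (inj₂ b₂) =
      ⊥-elim (unreachable T T<b (⊆ₕ-trans (sep-inʳ parts) sub) (w , b₂) (sep-disjˡ parts a₁) sat₂)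
    by-parts (inj₂ a₂) (inj₁ b₁) =
      ⊥-elim (unreachable S S<b (⊆ₕ-trans (sep-inˡ parts) sub) (w , b₁) (sep-disjʳ parts a₂) sat₁)

-- The resulting heap g meets
-- the hypotheses of the collapse lemma, with h as the collapse of g.
module TwoCells (h L P : Heap) (parts : Sep h L P) (a b c : ℕ) (L-a : a ∈Dom L)
  (a<b : a < b) (h-b : at h b ≡ nothing) (below-b : ∀ x {p q} → at h x ≡ just (p , q) → p < b)
  where

  a≢0 : a ≢ 0
  a≢0 a≡0 = just≢nothing (trans (sym (subst (λ m → at L m ≡ just (proj₁ L-a)) a≡0 (proj₂ L-a))) (at0 L))

  b≢0 : b ≢ 0
  b≢0 = m<n⇒n≢0 a<b

  b≢a : b ≢ a
  b≢a = >⇒≢ a<b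

  mid : Heap
  mid = extend P b (c , suc a) b≢0

  g : Heap
  g = extend mid a (b , 0) a≢0

  P-a : at P a ≡ nothing
  P-a = sep-disjˡ parts (proj₂ L-a)

  P-b : at P b ≡ nothing
  P-b = proj₂ (sep-free parts h-b)

  g-split : Sep g (cellH a (b , 0) a≢0) mid
  g-split = extend-sep mid a (b , 0) a≢0 (trans (extend-there P b (c , suc a) b≢0 (λ a≡b → b≢a (sym a≡b))) P-a)

  mid-split : Sep mid (cellH b (c , suc a) b≢0) P
  mid-split = extend-sep P b (c , suc a) b≢0 P-b

  g-a : at g a ≡ just (b , 0)
  g-a = extend-here mid a (b , 0) a≢0

  g-b : at g b ≡ just (c , suc a)
  g-b = trans (extend-there mid a (b , 0) a≢0 b≢a) (extend-here P b (c , suc a) b≢0)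

  g-other : ∀ {x} → x ≢ a → x ≢ b → at g x ≡ at P x
  g-other x≢a x≢b = trans (extend-there mid a (b , 0) a≢0 x≢a) (extend-there P b (c , suc a) b≢0 x≢b)

  only-a→b : ∀ x {p q} → x ≢ a → x ≢ b → at g x ≡ just (p , q) → p ≢ b
  only-a→b x x≢a x≢b e p≡b =
    <-irrefl p≡b (below-b x (within (sep-inʳ parts) x (trans (sym (g-other x≢a x≢b)) e)))

  L-b : at L b ≡ nothing
  L-b = proj₁ (sep-free parts h-b)

  L-disj : ∀ x {v} → x ≢ a → x ≢ b → at g x ≡ just v → at L x ≡ nothing
  L-disj x x≢a x≢b e = sep-disjʳ parts (trans (sym (g-other x≢a x≢b)) e)

  h-outside-L : ∀ x → at L x ≡ nothing → x ≢ b → at h x ≡ at g x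
  h-outside-L x L-x x≢b =
    trans (sep-outsideˡ parts L-x) (sym (g-other (λ x≡a → alloc≢free L L-x (proj₂ L-a) (sym x≡a)) x≢b))

ls-case : Term → Term → SH → Formula
ls-case t u φ = spatF (ls t u) *F ⌜ φ ⌝

empty-case : Term → Term → SH → Formula
empty-case t u φ = pureF (t ≐ u) ∧F ⌜ φ ⌝

two-cell-case : Term → Term → SH → Var → Var → Var → Formula
two-cell-case t u φ z y₁ y₂ = spatF (t ↦⟨ var z , var y₁ ⟩) *F (spatF (var z ↦⟨ u , var y₂ ⟩) *F ⌜ φ ⌝)

FreshFor : Term → Term → SH → (n : ℕ) → (Fin n → SH) → Var → Var → Var → Set
FreshFor t u φ n ψ z y₁ y₂ =
  ∀ x → x ≡ z ⊎ x ≡ y₁ ⊎ x ≡ y₂ → ¬ OccT x t × ¬ OccT x u × ¬ OccSH x φ × (∀ i → ¬ OccSH x (ψ i))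

empty-instance : ∀ t u φ → empty-case t u φ ⊫ ls-case t u φ
empty-instance t u φ s h (t≡u , φ-sat) =
  emptyH , h , split (sep-comm (sep-emptyʳ {h})) , (1 , inj₁ (t≡u , λ _ → refl)) , φ-sat

two-cell-instance : ∀ t u φ z y₁ y₂ → two-cell-case t u φ z y₁ y₂ ⊫ ls-case t u φ
two-cell-instance t u φ z y₁ y₂ s h (h₁ , h₂ , sp , cl₁ , h₃ , h₄ , sp₂ , cl₂ , φ-sat) =
  h ∖ h₄ , h₄ , split (∖-split {h} {h₄} (⊆ₕ-trans (sep-inʳ parts₂) (sep-inʳ parts))) ,
  (3 , two-cells-ls (∖-assoc parts parts₂) cl₁ cl₂) , φ-sat
  where
  parts : Sep h h₁ h₂
  parts = sep sp
  parts₂ : Sep h₂ h₃ h₄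
  parts₂ = sep sp₂

nonempty-case : ∀ t u φ n ψ z y₁ y₂ → z ≢ y₁ → z ≢ y₂ → y₁ ≢ y₂ → FreshFor t u φ n ψ z y₁ y₂ →
  two-cell-case t u φ z y₁ y₂ ⊫ ⋁ n ψ →
  ∀ s h L P {k} → Sep h L P → ⟦ t ⟧ s ∈Dom L → LsK k (⟦ t ⟧ s) (⟦ u ⟧ s) L → s , P ⊨ ⌜ φ ⌝ → s , h ⊨ ⋁ n ψ
nonempty-case t u φ n ψ z y₁ y₂ z≢y₁ z≢y₂ y₁≢y₂ fresh H₂ s h L P parts L-a L-ls φ-sat =
  ⋁-map n ψ transfer (H₂ s′ g model)
  where
  a : ℕ
  a = ⟦ t ⟧ s
  c : ℕ
  c = ⟦ u ⟧ s
  open FreshAbove (fresh-address h (a ⊔ anchors s n ψ)) renaming (address to b)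
  open TwoCells h L P parts a b c L-a (m⊔n<o⇒m<o _ _ above) unallocated unpointed
  open Collapse s a b c 0 (suc a) g L g-a g-b b≢a 1+n≢n only-a→b L-a L-b L-disj L-ls

  s′ : Store
  s′ = ((s [ z ≔ b ]) [ y₁ ≔ 0 ]) [ y₂ ≔ suc a ]

  unchanged : ∀ {Occ : Var → Set} → (∀ x → x ≡ z ⊎ x ≡ y₁ ⊎ x ≡ y₂ → ¬ Occ x) → Agree Occ s s′
  unchanged avoid x occ = sym (begin
    s′ x                          ≡⟨ update-other _ y₂ (suc a) (λ x≡y₂ → avoid x (inj₂ (inj₂ x≡y₂)) occ) ⟩
    ((s [ z ≔ b ]) [ y₁ ≔ 0 ]) x  ≡⟨ update-other _ y₁ 0 (λ x≡y₁ → avoid x (inj₂ (inj₁ x≡y₁)) occ) ⟩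
    (s [ z ≔ b ]) x               ≡⟨ update-other s z b (λ x≡z → avoid x (inj₁ x≡z) occ) ⟩
    s x                           ∎)
    where open ≡-Reasoning

  t-unchanged : Agree (λ x → OccT x t) s s′
  t-unchanged = unchanged (λ x fr → proj₁ (fresh x fr))
  u-unchanged : Agree (λ x → OccT x u) s s′
  u-unchanged = unchanged (λ x fr → proj₁ (proj₂ (fresh x fr)))
  φ-unchanged : Agree (λ x → OccSH x φ) s s′
  φ-unchanged = unchanged (λ x fr → proj₁ (proj₂ (proj₂ (fresh x fr))))
  ψ-unchanged : ∀ i → Agree (λ x → OccSH x (ψ i)) s s′
  ψ-unchanged i = unchanged (λ x fr → proj₂ (proj₂ (proj₂ (fresh x fr))) i)

  model : s′ , g ⊨ two-cell-case t u φ z y₁ y₂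
  model =
    cellH a (b , 0) a≢0 , mid , split g-split ,
    cell-cong (cellH a (b , 0) a≢0) (term-agree t t-unchanged) s′-z s′-y₁ (cellH-cell a b 0 a≢0) ,
    cellH b (c , suc a) b≢0 , P , split mid-split ,
    cell-cong (cellH b (c , suc a) b≢0) s′-z (term-agree u u-unchanged) s′-y₂ (cellH-cell b c (suc a) b≢0) ,
    sh-agree φ φ-unchanged φ-sat
    where
    s′-z : b ≡ s′ z
    s′-z = sym (trans (update-other _ y₂ (suc a) z≢y₂) (trans (update-other _ y₁ 0 z≢y₁) (update-same s z b)))
    s′-y₁ : 0 ≡ s′ y₁
    s′-y₁ = sym (trans (update-other _ y₂ (suc a) y₁≢y₂) (update-same _ y₁ 0))
    s′-y₂ : suc a ≡ s′ y₂
    s′-y₂ = sym (update-same _ y₂ (suc a))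

  replaces : Replaces g h
  replaces = record { keeps-L = sep-inˡ parts ; agrees = h-outside-L ; drops-b = unallocated }

  transfer : ∀ i → s′ , g ⊨ ⌜ ψ i ⌝ → s , h ⊨ ⌜ ψ i ⌝
  transfer i ψ-sat =
    let (π , σ) = sh-agree (ψ i) (λ x occ → sym (ψ-unchanged i x occ)) ψ-sat
    in π , collapse (spatial (ψ i)) anchor<b ⊆ₕ-refl (_ , g-a) (_ , g-b) replaces σ
    where
    anchor<b : anchor s (spatial (ψ i)) < b
    anchor<b = ≤-<-trans (anchors-bound s n ψ i) (m⊔n<o⇒n<o _ _ above)

from-instances : ∀ t u φ n ψ z y₁ y₂ → z ≢ y₁ → z ≢ y₂ → y₁ ≢ y₂ → FreshFor t u φ n ψ z y₁ y₂ →
  empty-case t u φ ⊫ ⋁ n ψ → two-cell-case t u φ z y₁ y₂ ⊫ ⋁ n ψ → ls-case t u φ ⊫ ⋁ n ψ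
from-instances t u φ n ψ z y₁ y₂ z≢y₁ z≢y₂ y₁≢y₂ fresh H₀ H₂ s h (L , P , sp , (k , L-ls) , π , σ) =
  by-cases (ls-cases k L-ls)
  where
  parts : Sep h L P
  parts = sep sp
  by-cases : (⟦ t ⟧ s ≡ ⟦ u ⟧ s × EmptyH L) ⊎ ⟦ t ⟧ s ∈Dom L → s , h ⊨ ⋁ n ψ
  by-cases (inj₁ (t≡u , emp)) =
    H₀ s h (t≡u , π , satS-resp s (spatial φ) (pointwise λ x → sym (sep-outsideˡ parts (emp x))) σ)
  by-cases (inj₂ L-a) = nonempty-case t u φ n ψ z y₁ y₂ z≢y₁ z≢y₂ y₁≢y₂ fresh H₂ s h L P parts L-a L-ls (π , σ)

proposition6p1 : (t u : Term) (φ : SH) (n : ℕ) (ψ : Fin n → SH) (z y₁ y₂ : Var) →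
    z ≢ y₁ → z ≢ y₂ → y₁ ≢ y₂ →
    (∀ x → x ≡ z ⊎ x ≡ y₁ ⊎ x ≡ y₂ → ¬ OccT x t × ¬ OccT x u × ¬ OccSH x φ × (∀ i → ¬ OccSH x (ψ i))) →
    ((spatF (ls t u) *F ⌜ φ ⌝) ⊫ ⋁ n ψ)
    ⇔ (((pureF (t ≐ u) ∧F ⌜ φ ⌝) ⊫ ⋁ n ψ)
       × ((spatF (t ↦⟨ var z , var y₁ ⟩) *F (spatF (var z ↦⟨ u , var y₂ ⟩) *F ⌜ φ ⌝)) ⊫ ⋁ n ψ))
proposition6p1 t u φ n ψ z y₁ y₂ z≢y₁ z≢y₂ y₁≢y₂ fresh = mk⇔ to from
  where
  to : ls-case t u φ ⊫ ⋁ n ψ → (empty-case t u φ ⊫ ⋁ n ψ) × (two-cell-case t u φ z y₁ y₂ ⊫ ⋁ n ψ)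
  to H = (λ s h sat → H s h (empty-instance t u φ s h sat))
       , (λ s h sat → H s h (two-cell-instance t u φ z y₁ y₂ s h sat))
  from : (empty-case t u φ ⊫ ⋁ n ψ) × (two-cell-case t u φ z y₁ y₂ ⊫ ⋁ n ψ) → ls-case t u φ ⊫ ⋁ n ψ
  from (H₀ , H₂) = from-instances t u φ n ψ z y₁ y₂ z≢y₁ z≢y₂ y₁≢y₂ fresh H₀ H₂
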